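{- Let $A$ be a meet-complemented lattice. If $Da$ exists for every $a\in A$, then $\Box a$ exists for every $a\in A$ and $\Box a=\neg Da$ for every $a\in A$.
   Context: A meet-complemented lattice is a lattice $(A,\wedge,\vee)$, not necessarily distributive, such that for every $a\in A$ the element $\neg a=\max\{b\in A: a\wedge b\le c\text{ for all }c\in A\}$ exists; it is bounded, with least element $0$ and greatest element $1$. For $a\in A$, $\Box a$ denotes $\max\{b\in A: a\vee\neg b=1\}$ and $Da$ denotes the least $b\in A$ with $a\vee b=1$ (so $Da\le b$ iff $a\vee b=1$), when these exist. -}

module Defs where

open import Level using (Level; _⊔_)
open import Data.Product using (Σ; _×_; proj₁)
open import Relation.Binary.Lattice.Bundles using (BoundedLattice)

module _ {c ℓ₁ ℓ₂ : Level} (L : BoundedLattice c ℓ₁ ℓ₂) where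
  open BoundedLattice L

  IsMaximum : ∀ {p} → (Carrier → Set p) → Carrier → Set (c ⊔ p ⊔ ℓ₂)
  IsMaximum P m = P m × (∀ b → P b → b ≤ m)

  IsLeast : ∀ {p} → (Carrier → Set p) → Carrier → Set (c ⊔ p ⊔ ℓ₂)
  IsLeast P m = P m × (∀ b → P b → m ≤ b)

  MeetComplemented : Set (c ⊔ ℓ₂)
  MeetComplemented = ∀ a → Σ Carrier (IsMaximum (λ b → ∀ x → (a ∧ b) ≤ x))

  neg : MeetComplemented → Carrier → Carrier
  neg mc a = proj₁ (mc a)

  DExists : Set (c ⊔ ℓ₁ ⊔ ℓ₂)
  DExists = ∀ a → Σ Carrier (IsLeast (λ b → (a ∨ b) ≈ ⊤))

  D : DExists → Carrier → Carrier
  D d a = proj₁ (d a)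

  IsBox : MeetComplemented → Carrier → Carrier → Set (c ⊔ ℓ₁ ⊔ ℓ₂)
  IsBox mc a = IsMaximum (λ b → (a ∨ neg mc b) ≈ ⊤)

module Submission where

-- In a meet-complemented lattice the operation ¬ is
-- antitone and Galois-connected with itself: x ≤ ¬y iff y ≤ ¬x.  In
-- particular x ≤ ¬¬x.  D a is characterised by  D a ≤ b ⇔ a ∨ b = 1.
-- To see that ¬Da is the maximum of B = {b : a ∨ ¬b = 1}:
--   * ¬Da ∈ B: a ∨ Da = 1 and Da ≤ ¬¬Da, so a ∨ ¬¬Da = 1, since an
--     element above a "join-complement" is again one;
--   * ¬Da is an upper bound: a ∨ ¬b = 1 gives Da ≤ ¬b, so b ≤ ¬Da by the
--     Galois connection.

open import Defs
open import Level using (Level)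
open import Data.Product using (_,_; proj₁; proj₂)
open import Relation.Binary.Lattice.Bundles using (BoundedLattice)
import Relation.Binary.Lattice.Properties.MeetSemilattice as MeetProperties

module BoundedLatticeFacts {c ℓ₁ ℓ₂ : Level} (L : BoundedLattice c ℓ₁ ℓ₂) where
  open BoundedLattice L

  join-top-upward : ∀ {a b b′} → (a ∨ b) ≈ ⊤ → b ≤ b′ → (a ∨ b′) ≈ ⊤
  join-top-upward {a} {b} {b′} a∨b≈⊤ b≤b′ = antisym (maximum _)
    (trans (reflexive (Eq.sym a∨b≈⊤))
           (∨-least (x≤x∨y a b′) (trans b≤b′ (y≤x∨y a b′))))

module MeetComplementFacts {c ℓ₁ ℓ₂ : Level} (L : BoundedLattice c ℓ₁ ℓ₂)
                           (mc : MeetComplemented L) where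
  open BoundedLattice L
  open MeetProperties meetSemilattice using (∧-comm; ∧-monotonic)

  ¬_ : Carrier → Carrier
  ¬_ = neg L mc

  ∧-¬-bottom : ∀ x y → (x ∧ ¬ x) ≤ y
  ∧-¬-bottom x = proj₁ (proj₂ (mc x))

  ¬-greatest : ∀ x y → (∀ z → (x ∧ y) ≤ z) → y ≤ ¬ x
  ¬-greatest x = proj₂ (proj₂ (mc x))

  ¬-swap : ∀ {x y} → x ≤ ¬ y → y ≤ ¬ x
  ¬-swap {x} {y} x≤¬y = ¬-greatest x y λ z →
    trans (reflexive (∧-comm x y))
          (trans (∧-monotonic refl x≤¬y) (∧-¬-bottom y z))

  ≤-¬¬ : ∀ x → x ≤ ¬ ¬ x
  ≤-¬¬ x = ¬-swap refl

module DFacts {c ℓ₁ ℓ₂ : Level} (L : BoundedLattice c ℓ₁ ℓ₂)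
              (d : DExists L) where
  open BoundedLattice L

  ∨-D-top : ∀ a → (a ∨ D L d a) ≈ ⊤
  ∨-D-top a = proj₁ (proj₂ (d a))

  D-least : ∀ {a b} → (a ∨ b) ≈ ⊤ → D L d a ≤ b
  D-least {a} {b} = proj₂ (proj₂ (d a)) b

proposition3 : {c ℓ₁ ℓ₂ : Level} (L : BoundedLattice c ℓ₁ ℓ₂)
    (mc : MeetComplemented L) (d : DExists L) →
    ∀ a → IsBox L mc a (neg L mc (D L d a))
proposition3 L mc d a = ¬Da∈B , ¬Da-upper
  where
  open BoundedLattice L
  open BoundedLatticeFacts L
  open MeetComplementFacts L mc
  open DFacts L d

  ¬Da∈B : (a ∨ ¬ ¬ D L d a) ≈ ⊤
  ¬Da∈B = join-top-upward (∨-D-top a) (≤-¬¬ (D L d a))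

  ¬Da-upper : ∀ b → (a ∨ ¬ b) ≈ ⊤ → b ≤ ¬ D L d a
  ¬Da-upper b a∨¬b≈⊤ = ¬-swap (D-least a∨¬b≈⊤)
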